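{- For every positive integer $n$, let $h(n)=\sigma(n)/n$, where $\sigma(n)=\sum_{d\mid n}d$. Then $h(n)<1.28\, n^{1/4}$ for all positive integers $n$. -}

module Defs where

open import Data.Nat using (ℕ; suc)
open import Data.Nat.Divisibility using (_∣?_)
open import Data.List using (List; filter)
open import Data.List using (upTo)
open import Data.Nat.ListAction using (sum)
open import Data.Integer using (+_)
open import Data.Rational using (ℚ; _/_; _*_)

oneTo : ℕ → List ℕ
oneTo n = Data.List.map suc (upTo n)

σ : ℕ → ℕ
σ n = sum (filter (_∣? n) (oneTo n))

h : (n : ℕ) → .{{_ : Data.Nat.NonZero n}} → ℚ
h n = (+ σ n) / n

_⁴ : ℚ → ℚ
x ⁴ = x * x * x * x

{-# OPTIONS --safe #-}
module Submission where

-- Let s = ⌊√n⌋. A divisor of n larger than s has its cofactor among 1, ..., s, so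
-- σ(n) ≤ (1 + ... + s) + Σ_{e ≤ s} n / e ≤ s (s + 1) / 2 + n H_s, and for s ≥ 7 this gives
-- h(n) ≤ H_s + 7/12. An induction on s, starting at s = 7, shows (H_s + 7/12)² < 1.28² s; it
-- goes through because also H_s + 7/12 ≤ s / 2. Squaring once more and using s² ≤ n yields
-- h(n)⁴ < 1.28⁴ n for n ≥ 49; the cases n ≤ 48 are checked by evaluation.

open import Defs

module DivisorSumBound where
  open import Data.Empty using (⊥-elim)
  open import Data.Fin using (Fin; toℕ; fromℕ<)
  open import Data.Fin.Properties using (all?; toℕ-fromℕ<)
  open import Data.List using ([]; _∷_; filter; map; upTo; _++_)
  open import Data.List.Properties using (upTo-∷ʳ; map-++)
  open import Data.Nat
  open import Data.Nat.DivMod using (m/n*n≤m; m*n/n≡m)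
  open import Data.Nat.Divisibility using (_∣?_; divides)
  open import Data.Nat.ListAction using (sum)
  open import Data.Nat.ListAction.Properties using (sum-++)
  open import Data.Nat.Properties
  open import Algebra.Properties.CommutativeSemigroup +-commutativeSemigroup using (interchange)
  open import Data.Nat.Tactic.RingSolver using (solve-∀; solve)
  open import Data.Product using (∃-syntax; _×_; _,_; proj₁)
  open import Data.Sum using ([_,_]′)
  open import Relation.Nullary using (Dec; yes; no)
  open import Relation.Nullary.Decidable using (from-yes)
  open import Relation.Unary using (Decidable)
  open import Relation.Binary.PropositionalEquality

  -- ∑[ d ≤ k ] f d = f 1 + ... + f k: the index starts at 1.
  infixr 8 ∑
  ∑ : ℕ → (ℕ → ℕ) → ℕ
  ∑ zero    f = 0
  ∑ (suc k) f = ∑ k f + f (suc k)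

  syntax ∑ k (λ d → e) = ∑[ d ≤ k ] e

  ∑-mono-≤ : ∀ k {f g : ℕ → ℕ} → (∀ {d} → 1 ≤ d → d ≤ k → f d ≤ g d) → ∑ k f ≤ ∑ k g
  ∑-mono-≤ zero    f≤g = z≤n
  ∑-mono-≤ (suc k) f≤g =
    +-mono-≤ (∑-mono-≤ k (λ 1≤d d≤k → f≤g 1≤d (m≤n⇒m≤1+n d≤k))) (f≤g (s≤s z≤n) ≤-refl)

  ∑-mono-≤-range : ∀ {k m} (f : ℕ → ℕ) → k ≤ m → ∑ k f ≤ ∑ m f
  ∑-mono-≤-range f k≤m = go (≤⇒≤′ k≤m)
    where
    go : ∀ {k m} → k ≤′ m → ∑ k f ≤ ∑ m f
    go ≤′-refl        = ≤-refl
    go (≤′-step k≤′m) = ≤-trans (go k≤′m) (m≤m+n _ _)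

  term≤∑ : ∀ k (f : ℕ → ℕ) {e} → 1 ≤ e → e ≤ k → f e ≤ ∑ k f
  term≤∑ k f {suc e} _ e<k = ≤-trans (m≤n+m (f (suc e)) (∑ e f)) (∑-mono-≤-range f e<k)

  ∑-distrib-+ : ∀ k (f g : ℕ → ℕ) → ∑[ d ≤ k ] (f d + g d) ≡ ∑ k f + ∑ k g
  ∑-distrib-+ zero    f g = refl
  ∑-distrib-+ (suc k) f g rewrite ∑-distrib-+ k f g =
    interchange (∑ k f) (∑ k g) (f (suc k)) (g (suc k))

  ∑-vanish : ∀ k {f : ℕ → ℕ} → (∀ {d} → 1 ≤ d → d ≤ k → f d ≡ 0) → ∑ k f ≡ 0
  ∑-vanish zero    f≡0 = refl
  ∑-vanish (suc k) f≡0
    rewrite ∑-vanish k (λ 1≤d d≤k → f≡0 1≤d (m≤n⇒m≤1+n d≤k)) = f≡0 (s≤s z≤n) ≤-refl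

  ∑-comm : ∀ m n (g : ℕ → ℕ → ℕ) → ∑[ d ≤ m ] ∑[ e ≤ n ] g d e ≡ ∑[ e ≤ n ] ∑[ d ≤ m ] g d e
  ∑-comm zero    n g = sym (∑-vanish n (λ _ _ → refl))
  ∑-comm (suc m) n g = begin
    ∑[ d ≤ m ] ∑[ e ≤ n ] g d e + ∑[ e ≤ n ] g (suc m) e  ≡⟨ cong (_+ ∑[ e ≤ n ] g (suc m) e) (∑-comm m n g) ⟩
    ∑[ e ≤ n ] ∑[ d ≤ m ] g d e + ∑[ e ≤ n ] g (suc m) e  ≡⟨ ∑-distrib-+ n _ _ ⟨
    ∑[ e ≤ n ] ∑[ d ≤ suc m ] g d e                       ∎
    where open ≡-Reasoning

  ∑-≤-single : ∀ k {f : ℕ → ℕ} d₀ → (∀ {d} → d ≢ d₀ → f d ≡ 0) → ∑ k f ≤ f d₀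
  ∑-≤-single zero        d₀ f≡0 = z≤n
  ∑-≤-single (suc k) {f} d₀ f≡0 with suc k ≟ d₀
  ... | yes refl = ≤-reflexive (cong (_+ f (suc k)) (∑-vanish k (λ _ d≤k → f≡0 (<⇒≢ (s≤s d≤k)))))
  ... | no k+1≢d₀ rewrite f≡0 k+1≢d₀ | +-identityʳ (∑ k f) = ∑-≤-single k d₀ f≡0

  2*∑-id : ∀ s → 2 * ∑[ d ≤ s ] d ≡ s * suc s
  2*∑-id zero    = refl
  2*∑-id (suc s) = begin
    2 * (∑[ d ≤ s ] d + suc s)    ≡⟨ *-distribˡ-+ 2 (∑[ d ≤ s ] d) (suc s) ⟩
    2 * ∑[ d ≤ s ] d + 2 * suc s  ≡⟨ cong (_+ 2 * suc s) (2*∑-id s) ⟩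
    s * suc s + 2 * suc s         ≡⟨ solve (s ∷ []) ⟩
    suc s * suc (suc s)           ∎
    where open ≡-Reasoning

  keepIf : {P : Set} → Dec P → ℕ → ℕ
  keepIf (yes _) x = x
  keepIf (no _)  x = 0

  keepIf-≤ : ∀ {P : Set} (p? : Dec P) x → keepIf p? x ≤ x
  keepIf-≤ (yes _) x = ≤-refl
  keepIf-≤ (no _)  x = z≤n

  keepIf-holds : ∀ {P : Set} (p? : Dec P) {x} → P → keepIf p? x ≡ x
  keepIf-holds (yes _) p = refl
  keepIf-holds (no ¬p) p = ⊥-elim (¬p p)

  sum-filter : ∀ {P : ℕ → Set} (P? : Decidable P) xs →
               sum (filter P? xs) ≡ sum (map (λ x → keepIf (P? x) x) xs)
  sum-filter P? []       = refl
  sum-filter P? (x ∷ xs) with P? x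
  ... | yes _ = cong (x +_) (sum-filter P? xs)
  ... | no _  = sum-filter P? xs

  sum-map-oneTo : ∀ (f : ℕ → ℕ) k → sum (map f (oneTo k)) ≡ ∑ k f
  sum-map-oneTo f zero    = refl
  sum-map-oneTo f (suc k) = begin
    sum (map f (map suc (upTo (suc k))))             ≡⟨ cong (λ l → sum (map f (map suc l))) (upTo-∷ʳ k) ⟨
    sum (map f (map suc (upTo k ++ k ∷ [])))         ≡⟨ cong (λ l → sum (map f l)) (map-++ suc (upTo k) (k ∷ [])) ⟩
    sum (map f (oneTo k ++ suc k ∷ []))              ≡⟨ cong sum (map-++ f (oneTo k) (suc k ∷ [])) ⟩
    sum (map f (oneTo k) ++ f (suc k) ∷ [])          ≡⟨ sum-++ (map f (oneTo k)) (f (suc k) ∷ []) ⟩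
    sum (map f (oneTo k)) + (f (suc k) + 0)          ≡⟨ cong₂ _+_ (sum-map-oneTo f k) (+-identityʳ (f (suc k))) ⟩
    ∑ k f + f (suc k)                                ∎
    where open ≡-Reasoning

  σ≡∑ : ∀ n → σ n ≡ ∑[ d ≤ n ] keepIf (d ∣? n) d
  σ≡∑ n = trans (sum-filter (_∣? n) (oneTo n)) (sum-map-oneTo _ n)

  -- Division with the junk value n /′ 0 = 0, so that quotients can be summed over e without
  -- a NonZero instance.
  _/′_ : ℕ → ℕ → ℕ
  n /′ zero  = 0
  n /′ suc e = n / suc e

  ∑-cofactor≤quotient : ∀ k n {e} → 1 ≤ e → ∑[ d ≤ k ] keepIf (d * e ≟ n) d ≤ n /′ e
  ∑-cofactor≤quotient k n {suc e} _ = ≤-trans (∑-≤-single k (n / suc e) vanishes) (keepIf-≤ _ _)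
    where
    vanishes : ∀ {d} → d ≢ n / suc e → keepIf (d * suc e ≟ n) d ≡ 0
    vanishes {d} d≢n/e with d * suc e ≟ n
    ... | yes de≡n = ⊥-elim (d≢n/e (trans (sym (m*n/n≡m d (suc e))) (cong (_/ suc e) de≡n)))
    ... | no _     = refl

  divisor≤small+cofactor : ∀ {n s d} → 1 ≤ d → d ≤ n → n < suc s * suc s →
    keepIf (d ∣? n) d ≤ keepIf (d ≤? s) d + ∑[ e ≤ s ] keepIf (d * e ≟ n) d
  divisor≤small+cofactor {n} {s} {d} 1≤d d≤n n<[s+1]² with d ∣? n
  ... | no _ = z≤n
  ... | yes (divides q n≡qd) with d ≤? s
  ...   | yes _   = m≤m+n d _
  ...   | no d≰s  = begin
    d                                   ≡⟨ keepIf-holds (d * q ≟ n) (trans (*-comm d q) (sym n≡qd)) ⟨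
    keepIf (d * q ≟ n) d                ≤⟨ term≤∑ s (λ e → keepIf (d * e ≟ n) d) 1≤q q≤s ⟩
    ∑[ e ≤ s ] keepIf (d * e ≟ n) d     ∎
    where
    open ≤-Reasoning
    1≤q : 1 ≤ q
    1≤q = n≢0⇒n>0 λ q≡0 → <⇒≢ (≤-trans 1≤d d≤n) (sym (trans n≡qd (cong (_* d) q≡0)))
    q≤s : q ≤ s
    q≤s = ≮⇒≥ λ s<q → <⇒≱ n<[s+1]² (≤-trans (*-mono-≤ s<q (≰⇒> d≰s)) (≤-reflexive (sym n≡qd)))

  ∑-small≤∑-id : ∀ k s → ∑[ d ≤ k ] keepIf (d ≤? s) d ≤ ∑[ d ≤ s ] d
  ∑-small≤∑-id zero    s = z≤n
  ∑-small≤∑-id (suc k) s with suc k ≤? s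
  ... | yes k<s = ≤-trans (+-monoˡ-≤ (suc k) (∑-mono-≤ k (λ {d} _ _ → keepIf-≤ (d ≤? s) d)))
                          (∑-mono-≤-range (λ d → d) k<s)
  ... | no _    = ≤-trans (≤-reflexive (+-identityʳ _)) (∑-small≤∑-id k s)

  σ≤-split-at-√ : ∀ {n s} → n < suc s * suc s → σ n ≤ ∑[ d ≤ s ] d + ∑[ e ≤ s ] n /′ e
  σ≤-split-at-√ {n} {s} n<[s+1]² = begin
    σ n                                                             ≡⟨ σ≡∑ n ⟩
    ∑[ d ≤ n ] keepIf (d ∣? n) d
      ≤⟨ ∑-mono-≤ n (λ 1≤d d≤n → divisor≤small+cofactor 1≤d d≤n n<[s+1]²) ⟩
    ∑[ d ≤ n ] (keepIf (d ≤? s) d + ∑[ e ≤ s ] keepIf (d * e ≟ n) d)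
      ≡⟨ ∑-distrib-+ n _ _ ⟩
    ∑[ d ≤ n ] keepIf (d ≤? s) d + ∑[ d ≤ n ] ∑[ e ≤ s ] keepIf (d * e ≟ n) d
      ≡⟨ cong (∑[ d ≤ n ] keepIf (d ≤? s) d +_) (∑-comm n s _) ⟩
    ∑[ d ≤ n ] keepIf (d ≤? s) d + ∑[ e ≤ s ] ∑[ d ≤ n ] keepIf (d * e ≟ n) d
      ≤⟨ +-mono-≤ (∑-small≤∑-id n s) (∑-mono-≤ s (λ 1≤e _ → ∑-cofactor≤quotient n n 1≤e)) ⟩
    ∑[ d ≤ s ] d + ∑[ e ≤ s ] n /′ e                                ∎
    where open ≤-Reasoning

  -- H! s = s! · H_s, the numerator of the harmonic number H_s = 1 + 1/2 + ... + 1/s over s!.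
  H! : ℕ → ℕ
  H! zero    = 0
  H! (suc s) = suc s * H! s + s !

  ∑-quotients≤harmonic : ∀ n s → s ! * ∑[ e ≤ s ] n /′ e ≤ n * H! s
  ∑-quotients≤harmonic n zero    = z≤n
  ∑-quotients≤harmonic n (suc s) = begin
    suc s * s ! * (∑[ e ≤ s ] n /′ e + n / suc s)
      ≡⟨ expand (suc s) (s !) (∑[ e ≤ s ] n /′ e) (n / suc s) ⟩
    suc s * (s ! * ∑[ e ≤ s ] n /′ e) + s ! * (n / suc s * suc s)
      ≤⟨ +-mono-≤ (*-monoʳ-≤ (suc s) (∑-quotients≤harmonic n s)) (*-monoʳ-≤ (s !) (m/n*n≤m n (suc s))) ⟩
    suc s * (n * H! s) + s ! * n
      ≡⟨ collect (suc s) n (H! s) (s !) ⟩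
    n * (suc s * H! s + s !)
      ∎
    where
    open ≤-Reasoning
    expand : ∀ t f a b → t * f * (a + b) ≡ t * (f * a) + f * (b * t)
    expand = solve-∀
    collect : ∀ t n p f → t * (n * p) + f * n ≡ n * (t * p + f)
    collect = solve-∀

  -- The 7/12 absorbs the small divisors: s (s + 1) / 2 ≤ 7 s² / 12 ≤ 7 n / 12 once s ≥ 6.
  σ-ratio≤H+7/12 : ∀ {n s} → 7 ≤ s → s * s ≤ n → n < suc s * suc s →
                     12 * s ! * σ n ≤ n * (12 * H! s + 7 * s !)
  σ-ratio≤H+7/12 {n} {s} 7≤s s²≤n n<[s+1]² = begin
    12 * s ! * σ n
      ≤⟨ *-monoʳ-≤ (12 * s !) (σ≤-split-at-√ {s = s} n<[s+1]²) ⟩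
    12 * s ! * (T + E)
      ≡⟨ distribute (s !) T E ⟩
    6 * s ! * (2 * T) + 12 * (s ! * E)
      ≡⟨ cong (λ z → 6 * s ! * z + 12 * (s ! * E)) (2*∑-id s) ⟩
    6 * s ! * (s * suc s) + 12 * (s ! * E)
      ≤⟨ +-mono-≤ (≤-trans (≤-reflexive (rearrange (s !) (s * suc s))) (*-monoʳ-≤ (s !) 6s[s+1]≤7n))
                  (*-monoʳ-≤ 12 (∑-quotients≤harmonic n s)) ⟩
    s ! * (7 * n) + 12 * (n * H! s)
      ≡⟨ collect (s !) n (H! s) ⟩
    n * (12 * H! s + 7 * s !)
      ∎
    where
    open ≤-Reasoning
    T = ∑[ d ≤ s ] d
    E = ∑[ e ≤ s ] n /′ e
    distribute : ∀ f t e → 12 * f * (t + e) ≡ 6 * f * (2 * t) + 12 * (f * e)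
    distribute = solve-∀
    rearrange : ∀ f a → 6 * f * a ≡ f * (6 * a)
    rearrange = solve-∀
    collect : ∀ f n p → f * (7 * n) + 12 * (n * p) ≡ n * (12 * p + 7 * f)
    collect = solve-∀
    6s[s+1]≤7n : 6 * (s * suc s) ≤ 7 * n
    6s[s+1]≤7n = begin
      6 * (s * suc s)       ≡⟨ solve (s ∷ []) ⟩
      6 * s + 6 * (s * s)   ≤⟨ +-monoˡ-≤ (6 * (s * s)) (*-monoˡ-≤ s (≤-trans (n≤1+n 6) 7≤s)) ⟩
      s * s + 6 * (s * s)   ≡⟨ solve (s ∷ []) ⟩
      7 * (s * s)           ≤⟨ *-monoʳ-≤ 7 s²≤n ⟩
      7 * n                 ∎

  -- (x / y)² < 1.28² s and x / y ≤ s / 2, with denominators cleared (1.28² = 1024 / 625).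
  Controlled : ℕ → ℕ → ℕ → Set
  Controlled s x y = 625 * (x * x) < 1024 * s * (y * y) × 2 * x ≤ s * y

  -- Passing from x / y to x / y + 1 / (s + 1): the bound x / y ≤ s / 2 keeps the cross term
  -- 2 (x / y) / (s + 1) of the square below 1.
  controlled-step : ∀ {s x y} → 1 ≤ s → Controlled s x y →
                    Controlled (suc s) (suc s * x + y) (suc s * y)
  controlled-step {s} {x} {y} 1≤s (square< , 2x≤sy) = square<′ , 2x≤sy′
    where
    open ≤-Reasoning
    st+1≤t² : s * suc s + 1 ≤ suc s * suc s
    st+1≤t² = ≤-trans (≤-reflexive (+-comm (s * suc s) 1)) (+-monoˡ-≤ (s * suc s) (s≤s z≤n))
    cross : 625 * (2 * x * (suc s * y) + y * y) ≤ 1024 * (suc s * suc s) * (y * y)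
    cross = begin
      625 * (2 * x * (suc s * y) + y * y)
        ≤⟨ *-monoʳ-≤ 625 (+-monoˡ-≤ (y * y) (*-monoˡ-≤ (suc s * y) 2x≤sy)) ⟩
      625 * (s * y * (suc s * y) + y * y)
        ≡⟨ solve (s ∷ y ∷ []) ⟩
      625 * (s * suc s + 1) * (y * y)
        ≤⟨ *-monoˡ-≤ (y * y) (*-mono-≤ (≤ᵇ⇒≤ 625 1024 _) st+1≤t²) ⟩
      1024 * (suc s * suc s) * (y * y)
        ∎
    square<′ : 625 * ((suc s * x + y) * (suc s * x + y)) < 1024 * suc s * ((suc s * y) * (suc s * y))
    square<′ = begin-strict
      625 * ((suc s * x + y) * (suc s * x + y))
        ≡⟨ solve (s ∷ x ∷ y ∷ []) ⟩
      suc s * suc s * (625 * (x * x)) + 625 * (2 * x * (suc s * y) + y * y)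
        <⟨ +-mono-<-≤ (*-monoʳ-< (suc s * suc s) square<) cross ⟩
      suc s * suc s * (1024 * s * (y * y)) + 1024 * (suc s * suc s) * (y * y)
        ≡⟨ solve (s ∷ y ∷ []) ⟩
      1024 * suc s * ((suc s * y) * (suc s * y))
        ∎
    2x≤sy′ : 2 * (suc s * x + y) ≤ suc s * (suc s * y)
    2x≤sy′ = begin
      2 * (suc s * x + y)           ≡⟨ solve (s ∷ x ∷ y ∷ []) ⟩
      suc s * (2 * x) + 2 * y       ≤⟨ +-mono-≤ (*-monoʳ-≤ (suc s) 2x≤sy) (*-monoˡ-≤ y (s≤s 1≤s)) ⟩
      suc s * (s * y) + suc s * y   ≡⟨ solve (s ∷ y ∷ []) ⟩
      suc s * (suc s * y)           ∎

  harmonic-controlled : ∀ {s} → 7 ≤′ s → Controlled s (12 * H! s + 7 * s !) (12 * s !)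
  harmonic-controlled ≤′-refl = <ᵇ⇒< _ _ _ , ≤ᵇ⇒≤ _ _ _
  harmonic-controlled {suc s} (≤′-step 7≤′s) =
    subst₂ (Controlled (suc s)) (numerator (suc s) (H! s) (s !)) (denominator (suc s) (s !))
      (controlled-step {x = 12 * H! s + 7 * s !} {12 * s !} (≤-trans (s≤s z≤n) (≤′⇒≤ 7≤′s)) (harmonic-controlled 7≤′s))
    where
    numerator : ∀ t p f → t * (12 * p + 7 * f) + 12 * f ≡ 12 * (t * p + f) + 7 * (t * f)
    numerator = solve-∀
    denominator : ∀ t f → t * (12 * f) ≡ 12 * (t * f)
    denominator = solve-∀

  square-bound-of-smaller-ratio : ∀ {s a n x y} .{{_ : NonZero n}} → y * a ≤ n * x →
                   625 * (x * x) < 1024 * s * (y * y) → 625 * (a * a) < 1024 * s * (n * n)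
  square-bound-of-smaller-ratio {s} {a} {n} {x} {y} ya≤nx x²<sy² = *-cancelˡ-< (y * y) _ _ (begin-strict
    y * y * (625 * (a * a))      ≡⟨ solve (y ∷ a ∷ []) ⟩
    625 * ((y * a) * (y * a))    ≤⟨ *-monoʳ-≤ 625 (*-mono-≤ ya≤nx ya≤nx) ⟩
    625 * ((n * x) * (n * x))    ≡⟨ solve (n ∷ x ∷ []) ⟩
    n * n * (625 * (x * x))      <⟨ *-monoʳ-< (n * n) {{m*n≢0 n n}} x²<sy² ⟩
    n * n * (1024 * s * (y * y)) ≡⟨ solve (n ∷ s ∷ y ∷ []) ⟩
    y * y * (1024 * s * (n * n)) ∎)
    where open ≤-Reasoning

  -- (a / n)⁴ < 1.28⁴ n with denominators cleared (1.28 = 32 / 25).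
  QuarticBound : ℕ → ℕ → Set
  QuarticBound a n = a * a * a * a * 25 ^ 4 < 32 ^ 4 * n * (n * n * n * n)

  quartic-bound? : ∀ a n → Dec (QuarticBound a n)
  quartic-bound? a n = _ <? _

  square-bound⇒quartic-bound : ∀ {s a n} → s * s ≤ n →
                               625 * (a * a) < 1024 * s * (n * n) → QuarticBound a n
  square-bound⇒quartic-bound {s} {a} {n} s²≤n a²<sn² = begin-strict
    a * a * a * a * (625 * 625)               ≡⟨ square 625 a ⟩
    625 * (a * a) * (625 * (a * a))           <⟨ *-mono-< a²<sn² a²<sn² ⟩
    1024 * s * (n * n) * (1024 * s * (n * n)) ≡⟨ square′ 1024 s n ⟩
    1024 * 1024 * (s * s) * (n * n * n * n)   ≤⟨ *-monoˡ-≤ (n * n * n * n) (*-monoʳ-≤ (1024 * 1024) s²≤n) ⟩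
    1024 * 1024 * n * (n * n * n * n)         ∎
    where
    open ≤-Reasoning
    square : ∀ c a → a * a * a * a * (c * c) ≡ c * (a * a) * (c * (a * a))
    square = solve-∀
    square′ : ∀ c s n → c * s * (n * n) * (c * s * (n * n)) ≡ c * c * (s * s) * (n * n * n * n)
    square′ = solve-∀

  floor-√ : ∀ n → ∃[ s ] s * s ≤ n × n < suc s * suc s
  floor-√ zero = 0 , z≤n , s≤s z≤n
  floor-√ (suc n) with floor-√ n
  ... | s , s²≤n , n<[s+1]² with suc n <? suc s * suc s
  ...   | yes n+1<[s+1]² = s , m≤n⇒m≤1+n s²≤n , n+1<[s+1]²
  ...   | no n+1≮[s+1]²  = suc s , ≤-reflexive (sym n+1≡[s+1]²) ,
                           subst (_< suc (suc s) * suc (suc s)) (sym n+1≡[s+1]²)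
                                 (*-mono-< (n<1+n (suc s)) (n<1+n (suc s)))
    where
    n+1≡[s+1]² : suc n ≡ suc s * suc s
    n+1≡[s+1]² = ≤-antisym n<[s+1]² (≮⇒≥ n+1≮[s+1]²)

  σ-quartic-bound-large : ∀ {n} .{{_ : NonZero n}} → 49 ≤ n → QuarticBound (σ n) n
  σ-quartic-bound-large {n} 49≤n =
    let s , s²≤n , n<[s+1]² = floor-√ n
        7≤s : 7 ≤ s
        7≤s = ≮⇒≥ λ s<7 → <⇒≱ (≤-trans n<[s+1]² (*-mono-≤ s<7 s<7)) 49≤n
    in square-bound⇒quartic-bound {s} {σ n} {n} s²≤n
         (square-bound-of-smaller-ratio {s} {σ n} {n} {12 * H! s + 7 * s !} {12 * s !}
           (σ-ratio≤H+7/12 7≤s s²≤n n<[s+1]²) (proj₁ (harmonic-controlled (≤⇒≤′ 7≤s))))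

  σ-quartic-bound-small : ∀ {n} → 1 ≤ n → n ≤ 48 → QuarticBound (σ n) n
  σ-quartic-bound-small {suc m} _ m<48 =
    subst (λ k → QuarticBound (σ (suc k)) (suc k)) (toℕ-fromℕ< m<48) (checked (fromℕ< m<48))
    where
    checked : ∀ (i : Fin 48) → QuarticBound (σ (suc (toℕ i))) (suc (toℕ i))
    checked = from-yes (all? {n = 48} (λ i → quartic-bound? (σ (suc (toℕ i))) (suc (toℕ i))))

  σ-quartic-bound : ∀ n .{{_ : NonZero n}} → QuarticBound (σ n) n
  σ-quartic-bound n =
    [ σ-quartic-bound-small (>-nonZero⁻¹ n) , σ-quartic-bound-large ]′ (≤-<-connex n 48)

open DivisorSumBound using (QuarticBound; σ-quartic-bound)

open import Data.Integer as ℤ using (+_)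
open import Data.Integer.Properties using (pos-*)
import Data.Nat as ℕ
open import Data.Nat using (ℕ; NonZero; suc)
open import Data.Rational using (_/_; _*_; _<_; toℚᵘ)
open import Data.Rational.Properties using (toℚᵘ-homo-*; toℚᵘ-cancel-<; toℚᵘ-fromℚᵘ)
import Data.Rational.Unnormalised as ℚᵘ
import Data.Rational.Unnormalised.Properties as ℚᵘ
open import Relation.Binary.PropositionalEquality using (_≡_; refl; trans; cong; subst₂)

pos-⁴ : ∀ a → + (a ℕ.* a ℕ.* a ℕ.* a) ≡ + a ℤ.* + a ℤ.* + a ℤ.* + a
pos-⁴ a = trans (pos-* (a ℕ.* a ℕ.* a) a) (cong (ℤ._* + a) (trans (pos-* (a ℕ.* a) a) (cong (ℤ._* + a) (pos-* a a))))

toℚᵘ-⁴ : ∀ {p q} → toℚᵘ p ℚᵘ.≃ q → toℚᵘ (p ⁴) ℚᵘ.≃ q ℚᵘ.* q ℚᵘ.* q ℚᵘ.* q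
toℚᵘ-⁴ {p} p≃q =
  ℚᵘ.≃-trans (toℚᵘ-homo-* (p * p * p) p) (ℚᵘ.*-cong
    (ℚᵘ.≃-trans (toℚᵘ-homo-* (p * p) p) (ℚᵘ.*-cong
      (ℚᵘ.≃-trans (toℚᵘ-homo-* p p) (ℚᵘ.*-cong p≃q p≃q)) p≃q)) p≃q)

-- mkℚᵘ i k denotes i / (k + 1); the rational 128 / 100 is stored normalised as 32 / 25.
quartic-bound⇒ℚ : ∀ a n .{{_ : NonZero n}} → QuarticBound a n →
                  ((+ a) / n) ⁴ < ((+ 128) / 100) ⁴ * ((+ n) / 1)
quartic-bound⇒ℚ a n@(suc m) a⁴<n⁵ =
  toℚᵘ-cancel-< (ℚᵘ.<-respˡ-≃ (ℚᵘ.≃-sym lhs) (ℚᵘ.<-respʳ-≃ (ℚᵘ.≃-sym rhs) (ℚᵘ.*<* cross-multiplied)))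
  where
  u = ℚᵘ.mkℚᵘ (+ a) m
  v = ℚᵘ.mkℚᵘ (+ 32) 24
  w = ℚᵘ.mkℚᵘ (+ n) 0
  lhs : toℚᵘ (((+ a) / n) ⁴) ℚᵘ.≃ u ℚᵘ.* u ℚᵘ.* u ℚᵘ.* u
  lhs = toℚᵘ-⁴ (toℚᵘ-fromℚᵘ u)
  rhs : toℚᵘ (((+ 128) / 100) ⁴ * ((+ n) / 1)) ℚᵘ.≃ v ℚᵘ.* v ℚᵘ.* v ℚᵘ.* v ℚᵘ.* w
  rhs = ℚᵘ.≃-trans (toℚᵘ-homo-* (((+ 128) / 100) ⁴) ((+ n) / 1))
                   (ℚᵘ.*-cong (toℚᵘ-⁴ {(+ 128) / 100} {v} (ℚᵘ.*≡* refl)) (toℚᵘ-fromℚᵘ w))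
  n⁴ = n ℕ.* n ℕ.* n ℕ.* n
  cross-multiplied : + a ℤ.* + a ℤ.* + a ℤ.* + a ℤ.* + (25 ℕ.^ 4) ℤ.< + (32 ℕ.^ 4) ℤ.* + n ℤ.* + n⁴
  cross-multiplied =
    subst₂ ℤ._<_
      (trans (pos-* (a ℕ.* a ℕ.* a ℕ.* a) (25 ℕ.^ 4)) (cong (ℤ._* + (25 ℕ.^ 4)) (pos-⁴ a)))
      (trans (pos-* (32 ℕ.^ 4 ℕ.* n) n⁴) (cong (ℤ._* + n⁴) (pos-* (32 ℕ.^ 4) n)))
      (ℤ.+<+ a⁴<n⁵)

lemma3p3 : (n : ℕ) → .{{_ : NonZero n}} → h n ⁴ < ((+ 128) / 100) ⁴ * ((+ n) / 1)
lemma3p3 n = quartic-bound⇒ℚ (σ n) n (σ-quartic-bound n)
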